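{- Let $G$ be a chordal graph. Then the maximal cliques of $G$ are the rotunda of the cycle matroid $M(G)$ (identifying a clique with the edge set of the subgraph it induces), and every edge of the rotunda graph $R(M(G))$ is an edge of the reduced clique graph $C_R(G)$.
   Context: A graph is chordal if every cycle with at least four vertices has a chord. $M(G)$ is the cycle matroid of $G$ on its edge set. A flat $F$ of a matroid $M$ is modular if $r(F)+r(F')=r(F\cap F')+r(F\cup F')$ for every flat $F'$. A vertical cover of $M$ is a pair $(F,F')$ of flats, neither equal to $E(M)$, with $F\cup F'=E(M)$; it is a modular cover if both are modular. A set $X$ is round if $M|X$ has no vertical cover; a rotunda is a maximal round flat. The rotunda graph $R(M)$ has the rotunda as vertices, with distinct $R_1,R_2$ adjacent iff $R_1\cap R_2\neq\emptyset$ and there is a modular cover $(F_1,F_2)$ with $R_i\subseteq F_i$ and $F_1\cap F_2=R_1\cap R_2$. The reduced clique graph $C_R(G)$ has the maximal cliques of $G$ as vertices, with distinct $C_1,C_2$ adjacent iff $C_1\cap C_2\neq\emptyset$ and every path from a vertex of $C_1-C_2$ to a vertex of $C_2-C_1$ contains a vertex of $C_1\cap C_2$. -}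

module Defs where

open import Data.Nat using (ℕ; zero; suc; _+_; _∸_; _<_; _<ᵇ_)
open import Data.Bool using (Bool; true; false; _∧_; _∨_; not)
open import Data.Fin using (Fin; toℕ; inject₁; _≟_)
import Data.Fin as F
open import Data.Product using (Σ; _×_; ∃; ∃-syntax)
open import Data.Sum using (_⊎_)
open import Relation.Nullary using (¬_)
open import Relation.Nullary.Decidable using (⌊_⌋)
open import Relation.Binary.PropositionalEquality using (_≡_)
open import Function.Definitions using (Injective)

record Graph (n : ℕ) : Set where
  field
    adj    : Fin n → Fin n → Bool
    sym    : ∀ i j → adj i j ≡ adj j i
    irrefl : ∀ i → adj i i ≡ false
open Graph public

anyFin : ∀ {n} → (Fin n → Bool) → Bool
anyFin {zero}  f = false
anyFin {suc n} f = f F.zero ∨ anyFin (λ i → f (F.suc i))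

countFin : ∀ {n} → (Fin n → Bool) → ℕ
countFin {zero}  f = 0
countFin {suc n} f = (if f F.zero then 1 else 0) + countFin (λ i → f (F.suc i))
  where open import Data.Bool using (if_then_else_)

-- Edge sets: symmetric Boolean relations on vertices
-- (the edge {i,j} belongs to X iff X i j ≡ true).

ES : ℕ → Set
ES n = Fin n → Fin n → Bool

module _ {n : ℕ} where

  Sym : ES n → Set
  Sym X = ∀ i j → X i j ≡ X j i

  _⊆ₑ_ : ES n → ES n → Set
  X ⊆ₑ Y = ∀ i j → X i j ≡ true → Y i j ≡ true

  _≐_ : ES n → ES n → Set
  X ≐ Y = ∀ i j → X i j ≡ Y i j

  _∪ₑ_ : ES n → ES n → ES n
  (X ∪ₑ Y) i j = X i j ∨ Y i j

  _∩ₑ_ : ES n → ES n → ES n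
  (X ∩ₑ Y) i j = X i j ∧ Y i j

  addEdge : ES n → Fin n → Fin n → ES n
  addEdge X a b i j = X i j ∨ (⌊ i ≟ a ⌋ ∧ ⌊ j ≟ b ⌋) ∨ (⌊ i ≟ b ⌋ ∧ ⌊ j ≟ a ⌋)

  reach : ES n → ℕ → Fin n → Fin n → Bool
  reach X zero    u v = ⌊ u ≟ v ⌋
  reach X (suc k) u v = reach X k u v ∨ anyFin (λ w → reach X k u w ∧ X w v)

  -- number of connected components of (V, X): count the vertices that are
  -- the least vertex of their component
  components : ES n → ℕ
  components X = countFin (λ v → not (anyFin (λ u → (toℕ u <ᵇ toℕ v) ∧ reach X n u v)))

  -- rank function of the cycle matroid: r(X) = |V| - #components of (V, X)
  rank : ES n → ℕ
  rank X = n ∸ components X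

  -- F is a flat of the restriction M|X (M the cycle matroid)
  IsFlatIn : ES n → ES n → Set
  IsFlatIn X F = Sym F × F ⊆ₑ X ×
    (∀ a b → X a b ≡ true → F a b ≡ false → rank F < rank (addEdge F a b))

  VerticalCoverIn : ES n → ES n → ES n → Set
  VerticalCoverIn X F F' =
    IsFlatIn X F × IsFlatIn X F' × ¬ (F ≐ X) × ¬ (F' ≐ X) × (F ∪ₑ F') ≐ X

  Round : ES n → Set
  Round X = ¬ (Σ (ES n) λ F → Σ (ES n) λ F' → VerticalCoverIn X F F')

module _ {n : ℕ} (G : Graph n) where

  E : ES n
  E = adj G

  IsFlat : ES n → Set
  IsFlat = IsFlatIn E

  Modular : ES n → Set
  Modular F = IsFlat F ×
    (∀ F' → IsFlat F' → rank F + rank F' ≡ rank (F ∩ₑ F') + rank (F ∪ₑ F'))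

  Rotunda : ES n → Set
  Rotunda R = IsFlat R × Round R ×
    (∀ R' → IsFlat R' → Round R' → R ⊆ₑ R' → R' ≐ R)

  RotundaAdj : ES n → ES n → Set
  RotundaAdj R₁ R₂ = ¬ (R₁ ≐ R₂) ×
    (∃[ i ] ∃[ j ] (R₁ i j ≡ true × R₂ i j ≡ true)) ×
    (Σ (ES n) λ F₁ → Σ (ES n) λ F₂ →
       Modular F₁ × Modular F₂ × ¬ (F₁ ≐ E) × ¬ (F₂ ≐ E) × (F₁ ∪ₑ F₂) ≐ E ×
       R₁ ⊆ₑ F₁ × R₂ ⊆ₑ F₂ × (F₁ ∩ₑ F₂) ≐ (R₁ ∩ₑ R₂))

  VS : Set
  VS = Fin n → Bool

  _⊆ᵥ_ : VS → VS → Set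
  A ⊆ᵥ B = ∀ v → A v ≡ true → B v ≡ true

  _≐ᵥ_ : VS → VS → Set
  A ≐ᵥ B = ∀ v → A v ≡ B v

  IsClique : VS → Set
  IsClique C = ∀ u v → C u ≡ true → C v ≡ true → ¬ (u ≡ v) → adj G u v ≡ true

  MaximalClique : VS → Set
  MaximalClique C = IsClique C × (∀ C' → IsClique C' → C ⊆ᵥ C' → C' ≐ᵥ C)

  cliqueEdges : VS → ES n
  cliqueEdges C i j = C i ∧ C j ∧ adj G i j

  record Path (x y : Fin n) : Set where
    field
      len   : ℕ
      p     : Fin (suc len) → Fin n
      inj   : Injective _≡_ _≡_ p
      start : p F.zero ≡ x
      end   : p (F.fromℕ len) ≡ y
      step  : ∀ (i : Fin len) → adj G (p (inject₁ i)) (p (F.suc i)) ≡ true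

  ReducedCliqueAdj : VS → VS → Set
  ReducedCliqueAdj C₁ C₂ = ¬ (C₁ ≐ᵥ C₂) ×
    (∃[ v ] (C₁ v ≡ true × C₂ v ≡ true)) ×
    (∀ x y → C₁ x ≡ true → C₂ x ≡ false → C₂ y ≡ true → C₁ y ≡ false →
       (P : Path x y) →
       ∃[ i ] (C₁ (Path.p P i) ≡ true × C₂ (Path.p P i) ≡ true))

  Consec : (k : ℕ) → Fin k → Fin k → Set
  Consec k i j = suc (toℕ i) ≡ toℕ j ⊎ suc (toℕ j) ≡ toℕ i
               ⊎ (toℕ i ≡ 0 × suc (toℕ j) ≡ k) ⊎ (toℕ j ≡ 0 × suc (toℕ i) ≡ k)

  IsCycle : (k : ℕ) → (Fin k → Fin n) → Set
  IsCycle k c = Injective _≡_ _≡_ c × (∀ i j → Consec k i j → adj G (c i) (c j) ≡ true)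

  HasChord : (k : ℕ) → (Fin k → Fin n) → Set
  HasChord k c = ∃[ i ] ∃[ j ] (¬ (i ≡ j) × ¬ Consec k i j × adj G (c i) (c j) ≡ true)

  Chordal : Set
  Chordal = ∀ k (c : Fin k → Fin n) → 4 Data.Nat.≤ k → IsCycle k c → HasChord k c
    where import Data.Nat

  NoIsolatedVertices : Set
  NoIsolatedVertices = ∀ v → ∃[ u ] (adj G v u ≡ true)

{-# OPTIONS --safe #-}
-- In the cycle matroid, a flat F of M|X contains every edge of X joining two vertices connected in F, and an
-- edge set is a flat as soon as every missing edge has an endpoint isolated in it. If two non-isolated
-- vertices u ≠ w of a round set R were not adjacent in R, deleting the edges at u, resp. at w, would give a
-- vertical cover; so R consists of all edges of the clique of its non-isolated vertices. Conversely the edge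
-- set of a clique is a round flat, and maximality corresponds on both sides.
--
-- For a rotunda edge with cover (F₁, F₂), pick i ∈ C₁ ∩ C₂ and sort the neighbours v of i by whether iv
-- lies in F₁ or in F₂. Closedness of F₁ and F₂ forbids edges between the two sorts outside C₁ ∩ C₂, so a
-- shortest path from C₁ − C₂ to C₂ − C₁ avoiding C₁ ∩ C₂ would close up through i into a chordless cycle of
-- length at least four.
module Submission where

open import Defs hiding (sym)
open import Data.Nat using (ℕ; zero; suc; _+_; _∸_; _<_; _≤_; _<ᵇ_; z≤n; s≤s; _≤′_; ≤′-refl; ≤′-step)
open import Data.Nat.Properties hiding (_≟_)
open import Data.Nat.Induction using (<-rec)
open import Data.Bool using (Bool; true; false; _∧_; _∨_; not; if_then_else_)
open import Data.Bool.Properties using (∨-zeroʳ; ¬-not; T-≡) renaming (_≟_ to _≟ᵇ_)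
open import Data.Fin using (Fin; toℕ; inject₁; _≟_; inject)
import Data.Fin as F
open import Data.Fin.Properties using (any?; all?; ¬∀⟶∃¬; ¬∀⟶∃¬-smallest; toℕ-injective; toℕ-inject; toℕ-fromℕ<; toℕ<n; toℕ-fromℕ; toℕ-inject₁)
open import Data.Product using (Σ; _×_; _,_; proj₁; proj₂; ∃-syntax)
open import Data.Sum using (_⊎_; inj₁; inj₂; [_,_])
open import Data.Empty using (⊥; ⊥-elim)
open import Relation.Nullary using (¬_; yes; no; Dec; ¬?)
open import Relation.Nullary.Decidable using (⌊_⌋; dec-true; dec-false; isYes≗does; _×-dec_; decidable-stable)
open import Relation.Binary using (tri<; tri≈; tri>)
open import Relation.Binary.PropositionalEquality using (_≡_; _≢_; refl; sym; trans; cong; cong₂; subst; subst₂)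
open import Function.Base using (_∘_)
open import Function.Definitions using (Injective)
open import Function.Bundles using (Equivalence)

≡true⇒≢false : ∀ {b} → b ≡ true → b ≢ false
≡true⇒≢false refl ()

∧≡true⁺ : ∀ {a b} → a ≡ true → b ≡ true → a ∧ b ≡ true
∧≡true⁺ refl refl = refl

∧≡true⁻ : ∀ a {b} → a ∧ b ≡ true → a ≡ true × b ≡ true
∧≡true⁻ true p = refl , p

∨≡trueˡ⁺ : ∀ {a} b → a ≡ true → a ∨ b ≡ true
∨≡trueˡ⁺ b refl = refl

∨≡trueʳ⁺ : ∀ a {b} → b ≡ true → a ∨ b ≡ true
∨≡trueʳ⁺ a refl = ∨-zeroʳ a

∨≡true⁻ : ∀ a {b} → a ∨ b ≡ true → a ≡ true ⊎ b ≡ true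
∨≡true⁻ true  _ = inj₁ refl
∨≡true⁻ false p = inj₂ p

⇔true⇒≡ : ∀ {a b} → (a ≡ true → b ≡ true) → (b ≡ true → a ≡ true) → a ≡ b
⇔true⇒≡ {true}  {b}     f g = sym (f refl)
⇔true⇒≡ {false} {true}  f g = g refl
⇔true⇒≡ {false} {false} f g = refl

strictly-implies : ∀ {a b} → (a ≡ true → b ≡ true) → a ≢ b → a ≡ false × b ≡ true
strictly-implies {true}  f a≢b = ⊥-elim (a≢b (sym (f refl)))
strictly-implies {false} {true}  f a≢b = refl , refl
strictly-implies {false} {false} f a≢b = ⊥-elim (a≢b refl)

≟≡true⇒≡ : ∀ {n} {i j : Fin n} → ⌊ i ≟ j ⌋ ≡ true → i ≡ j
≟≡true⇒≡ {i = i} {j} p with i ≟ j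
... | yes i≡j = i≡j

≟-refl : ∀ {n} (i : Fin n) → ⌊ i ≟ i ⌋ ≡ true
≟-refl i = trans (isYes≗does (i ≟ i)) (dec-true (i ≟ i) refl)

≟-≢ : ∀ {n} {i j : Fin n} → i ≢ j → ⌊ i ≟ j ⌋ ≡ false
≟-≢ {i = i} {j} i≢j = trans (isYes≗does (i ≟ j)) (dec-false (i ≟ j) i≢j)

not≟⇒≢ : ∀ {n} {i j : Fin n} → not ⌊ i ≟ j ⌋ ≡ true → i ≢ j
not≟⇒≢ p refl = ≡true⇒≢false p (cong not (≟-refl _))

anyFin≡true⁺ : ∀ {n} (f : Fin n → Bool) i → f i ≡ true → anyFin f ≡ true
anyFin≡true⁺ f F.zero    p = ∨≡trueˡ⁺ _ p
anyFin≡true⁺ f (F.suc i) p = ∨≡trueʳ⁺ (f F.zero) (anyFin≡true⁺ (λ j → f (F.suc j)) i p)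

anyFin≡true⁻ : ∀ {n} (f : Fin n → Bool) → anyFin f ≡ true → ∃[ i ] f i ≡ true
anyFin≡true⁻ {suc n} f p with f F.zero in f0 | p
... | true  | _ = F.zero , f0
... | false | p′ with anyFin≡true⁻ (λ i → f (F.suc i)) p′
...   | i , fi = F.suc i , fi

anyFin-cong : ∀ {n} (f g : Fin n → Bool) → (∀ i → f i ≡ g i) → anyFin f ≡ anyFin g
anyFin-cong {zero}  f g f≗g = refl
anyFin-cong {suc n} f g f≗g =
  cong₂ _∨_ (f≗g F.zero) (anyFin-cong (λ i → f (F.suc i)) (λ i → g (F.suc i)) (λ i → f≗g (F.suc i)))

countFin-cong : ∀ {n} (f g : Fin n → Bool) → (∀ i → f i ≡ g i) → countFin f ≡ countFin g
countFin-cong {zero}  f g f≗g = refl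
countFin-cong {suc n} f g f≗g =
  cong₂ (λ b m → (if b then 1 else 0) + m) (f≗g F.zero)
        (countFin-cong (λ i → f (F.suc i)) (λ i → g (F.suc i)) (λ i → f≗g (F.suc i)))

countFin≤n : ∀ {n} (f : Fin n → Bool) → countFin f ≤ n
countFin≤n {zero}  f = z≤n
countFin≤n {suc n} f with f F.zero
... | true  = s≤s (countFin≤n (λ i → f (F.suc i)))
... | false = m≤n⇒m≤1+n (countFin≤n (λ i → f (F.suc i)))

private
  indicator-mono : ∀ {a b} → (a ≡ true → b ≡ true) → (if a then 1 else 0) ≤ (if b then 1 else 0)
  indicator-mono {true}  a⇒b rewrite a⇒b refl = ≤-refl
  indicator-mono {false} a⇒b = z≤n

  indicator-< : ∀ {a b} → a ≡ false → b ≡ true → (if a then 1 else 0) < (if b then 1 else 0)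
  indicator-< refl refl = s≤s z≤n

countFin-mono : ∀ {n} (f g : Fin n → Bool) → (∀ i → f i ≡ true → g i ≡ true) → countFin f ≤ countFin g
countFin-mono {zero}  f g f⇒g = z≤n
countFin-mono {suc n} f g f⇒g =
  +-mono-≤ (indicator-mono (f⇒g F.zero))
           (countFin-mono (λ i → f (F.suc i)) (λ i → g (F.suc i)) (λ i → f⇒g (F.suc i)))

countFin-mono-< : ∀ {n} (f g : Fin n → Bool) → (∀ i → f i ≡ true → g i ≡ true) →
  ∀ j → f j ≡ false → g j ≡ true → countFin f < countFin g
countFin-mono-< f g f⇒g F.zero fj gj =
  +-mono-<-≤ (indicator-< fj gj)
             (countFin-mono (λ i → f (F.suc i)) (λ i → g (F.suc i)) (λ i → f⇒g (F.suc i)))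
countFin-mono-< f g f⇒g (F.suc j) fj gj =
  +-mono-≤-< (indicator-mono (f⇒g F.zero))
             (countFin-mono-< (λ i → f (F.suc i)) (λ i → g (F.suc i)) (λ i → f⇒g (F.suc i)) j fj gj)

countFin>0 : ∀ {n} (f : Fin n → Bool) i → f i ≡ true → 0 < countFin f
countFin>0 f F.zero    fi rewrite fi = s≤s z≤n
countFin>0 f (F.suc i) fi = <-≤-trans (countFin>0 (λ j → f (F.suc j)) i fi) (m≤n+m _ _)

module _ {n : ℕ} (X : ES n) where

  reach-suc : ∀ k {u v} → reach X k u v ≡ true → reach X (suc k) u v ≡ true
  reach-suc k = ∨≡trueˡ⁺ _

  reach-suc⁻ : ∀ k {u v} → reach X (suc k) u v ≡ true →
    reach X k u v ≡ true ⊎ ∃[ w ] (reach X k u w ≡ true × X w v ≡ true)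
  reach-suc⁻ k {u} {v} p with ∨≡true⁻ (reach X k u v) p
  ... | inj₁ p′ = inj₁ p′
  ... | inj₂ p′ with anyFin≡true⁻ (λ w → reach X k u w ∧ X w v) p′
  ...   | w , q = inj₂ (w , ∧≡true⁻ (reach X k u w) q)

  reach-snoc : ∀ k {u w v} → reach X k u w ≡ true → X w v ≡ true → reach X (suc k) u v ≡ true
  reach-snoc k {u} {w} {v} p e =
    ∨≡trueʳ⁺ (reach X k u v) (anyFin≡true⁺ (λ w′ → reach X k u w′ ∧ X w′ v) w (∧≡true⁺ p e))

  reach-refl : ∀ k u → reach X k u u ≡ true
  reach-refl zero    u = ≟-refl u
  reach-refl (suc k) u = reach-suc k (reach-refl k u)

  reach-≤ : ∀ {k m u v} → k ≤ m → reach X k u v ≡ true → reach X m u v ≡ true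
  reach-≤ k≤m = go (≤⇒≤′ k≤m)
    where
      go : ∀ {k m u v} → k ≤′ m → reach X k u v ≡ true → reach X m u v ≡ true
      go ≤′-refl          p = p
      go (≤′-step {m} k≤′m) p = reach-suc m (go k≤′m p)

  reach-trans : ∀ a b {u v w} → reach X a u v ≡ true → reach X b v w ≡ true → reach X (b + a) u w ≡ true
  reach-trans a zero    p q with refl ← ≟≡true⇒≡ q = p
  reach-trans a (suc b) p q with reach-suc⁻ b q
  ... | inj₁ q′            = reach-suc (b + a) (reach-trans a b p q′)
  ... | inj₂ (w , q′ , e) = reach-snoc (b + a) (reach-trans a b p q′) e

  Connected : Fin n → Fin n → Set
  Connected u v = ∃[ k ] reach X k u v ≡ true

  connected-refl : ∀ u → Connected u u
  connected-refl u = 0 , reach-refl 0 u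

  connected-trans : ∀ {u v w} → Connected u v → Connected v w → Connected u w
  connected-trans (a , p) (b , q) = b + a , reach-trans a b p q

  connected-edge : ∀ {u v} → X u v ≡ true → Connected u v
  connected-edge {u} e = 1 , reach-snoc 0 (reach-refl 0 u) e

  connected-sym : Sym X → ∀ {u v} → Connected u v → Connected v u
  connected-sym symX (k , p) = go k p
    where
      go : ∀ k {u v} → reach X k u v ≡ true → Connected v u
      go zero p with refl ← ≟≡true⇒≡ p = connected-refl _
      go (suc k) p with reach-suc⁻ k p
      ... | inj₁ p′           = go k p′
      ... | inj₂ (w , p′ , e) = connected-trans (connected-edge (trans (symX _ w) e)) (go k p′)

  Stable : Fin n → ℕ → Set
  Stable u j = ∀ v → reach X (suc j) u v ≡ reach X j u v

  stable-+ : ∀ {u j} → Stable u j → ∀ t v → reach X (t + j) u v ≡ reach X j u v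
  stable-+         st zero    v = refl
  stable-+ {u} {j} st (suc t) v =
    trans (cong₂ _∨_ (stable-+ st t v) (anyFin-cong _ _ λ w → cong (_∧ X w v) (stable-+ st t w)))
          (st v)

  -- Before stabilising, each step reaches a new vertex; so stabilisation happens within n steps.
  stable-or-growing : ∀ u k → (∃[ j ] (j ≤ k × Stable u j)) ⊎ k < countFin (reach X k u)
  stable-or-growing u zero = inj₂ (countFin>0 (reach X 0 u) u (reach-refl 0 u))
  stable-or-growing u (suc k) with stable-or-growing u k
  ... | inj₁ (j , j≤k , st) = inj₁ (j , m≤n⇒m≤1+n j≤k , st)
  ... | inj₂ k<count with all? (λ v → reach X (suc k) u v ≟ᵇ reach X k u v)
  ...   | yes st  = inj₁ (k , n≤1+n k , st)
  ...   | no ¬st with ¬∀⟶∃¬ n _ (λ v → reach X (suc k) u v ≟ᵇ reach X k u v) ¬st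
  ...     | v , ≢ with strictly-implies (reach-suc k) (λ e → ≢ (sym e))
  ...       | new , new′ =
    inj₂ (≤-trans (s≤s k<count)
                  (countFin-mono-< (reach X k u) (reach X (suc k) u) (λ _ → reach-suc k) v new new′))

  connected⇒reach : ∀ {u v} → Connected u v → reach X n u v ≡ true
  connected⇒reach {u} {v} (k , p) with stable-or-growing u n
  ... | inj₂ n<count = ⊥-elim (<⇒≱ n<count (countFin≤n _))
  ... | inj₁ (j , j≤n , st) with k ≤? n
  ...   | yes k≤n = reach-≤ k≤n p
  ...   | no  k≰n = reach-≤ j≤n (trans (sym (stable-+ st (k ∸ j) v))
                                      (subst (λ t → reach X t u v ≡ true) (sym (m∸n+n≡m j≤k)) p))
    where j≤k = ≤-trans j≤n (<⇒≤ (≰⇒> k≰n))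

reach-mono : ∀ {n} {X Y : ES n} → X ⊆ₑ Y → ∀ k {u v} → reach X k u v ≡ true → reach Y k u v ≡ true
reach-mono X⊆Y zero    p = p
reach-mono {X = X} {Y} X⊆Y (suc k) p with reach-suc⁻ X k p
... | inj₁ p′           = reach-suc Y k (reach-mono X⊆Y k p′)
... | inj₂ (w , p′ , e) = reach-snoc Y k (reach-mono X⊆Y k p′) (X⊆Y _ _ e)

connected-mono : ∀ {n} {X Y : ES n} → X ⊆ₑ Y → ∀ {u v} → Connected X u v → Connected Y u v
connected-mono X⊆Y (k , p) = k , reach-mono X⊆Y k p

module _ {n : ℕ} where

  addEdge-ab : ∀ (X : ES n) a b → addEdge X a b a b ≡ true
  addEdge-ab X a b rewrite ≟-refl a | ≟-refl b = ∨≡trueʳ⁺ (X a b) refl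

  addEdge-ba : ∀ (X : ES n) a b → addEdge X a b b a ≡ true
  addEdge-ba X a b rewrite ≟-refl a | ≟-refl b =
    ∨≡trueʳ⁺ (X b a) (∨≡trueʳ⁺ (⌊ b ≟ a ⌋ ∧ ⌊ a ≟ b ⌋) refl)

  ⊆-addEdge : ∀ (X : ES n) a b → X ⊆ₑ addEdge X a b
  ⊆-addEdge X a b i j = ∨≡trueˡ⁺ _

  addEdge⁻ : ∀ (X : ES n) a b {i j} → addEdge X a b i j ≡ true →
    X i j ≡ true ⊎ (i ≡ a × j ≡ b) ⊎ (i ≡ b × j ≡ a)
  addEdge⁻ X a b {i} {j} p with ∨≡true⁻ (X i j) p
  ... | inj₁ q = inj₁ q
  ... | inj₂ q with ∨≡true⁻ (⌊ i ≟ a ⌋ ∧ ⌊ j ≟ b ⌋) q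
  ...   | inj₁ r = let i≟a , j≟b = ∧≡true⁻ ⌊ i ≟ a ⌋ r in inj₂ (inj₁ (≟≡true⇒≡ i≟a , ≟≡true⇒≡ j≟b))
  ...   | inj₂ r = let i≟b , j≟a = ∧≡true⁻ ⌊ i ≟ b ⌋ r in inj₂ (inj₂ (≟≡true⇒≡ i≟b , ≟≡true⇒≡ j≟a))

  connected-addEdge⁻ : ∀ {F : ES n} {a b} → Sym F → Connected F a b →
    ∀ {x y} → Connected (addEdge F a b) x y → Connected F x y
  connected-addEdge⁻ {F} {a} {b} symF a~b (k , p) = go k p
    where
      go : ∀ k {x y} → reach (addEdge F a b) k x y ≡ true → Connected F x y
      go zero    p = 0 , p
      go (suc k) p with reach-suc⁻ (addEdge F a b) k p
      ... | inj₁ p′ = go k p′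
      ... | inj₂ (w , p′ , e) with addEdge⁻ F a b e
      ...   | inj₁ e′                = connected-trans F (go k p′) (connected-edge F e′)
      ...   | inj₂ (inj₁ (refl , refl)) = connected-trans F (go k p′) a~b
      ...   | inj₂ (inj₂ (refl , refl)) = connected-trans F (go k p′) (connected-sym F symF a~b)

  components-cong : ∀ {X Y : ES n} → (∀ u v → reach X n u v ≡ reach Y n u v) → components X ≡ components Y
  components-cong X≗Y = countFin-cong _ _ λ v → cong not (anyFin-cong _ _ λ u → cong (_ ∧_) (X≗Y u v))

  rank-addEdge-connected : ∀ {F : ES n} {a b} → Sym F → Connected F a b → rank (addEdge F a b) ≡ rank F
  rank-addEdge-connected {F} {a} {b} symF a~b = cong (n ∸_) (components-cong λ u v → ⇔true⇒≡
    (λ p → connected⇒reach F (connected-addEdge⁻ symF a~b (n , p)))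
    (reach-mono (⊆-addEdge F a b) n))

  flat-closed : ∀ {X F : ES n} → IsFlatIn X F → ∀ {a b} → X a b ≡ true → Connected F a b → F a b ≡ true
  flat-closed {X} {F} (symF , _ , rank-jumps) {a} {b} Xab a~b with F a b in Fab
  ... | true  = refl
  ... | false = ⊥-elim (<-irrefl (sym (rank-addEdge-connected symF a~b)) (rank-jumps a b Xab Fab))

  flat-trans : ∀ {X F : ES n} → IsFlatIn X F → ∀ {p q r} →
    F p q ≡ true → F q r ≡ true → X p r ≡ true → F p r ≡ true
  flat-trans {F = F} flat Fpq Fqr Xpr =
    flat-closed flat Xpr (connected-trans F (connected-edge F Fpq) (connected-edge F Fqr))

  Isolated : ES n → Fin n → Set
  Isolated F a = ∀ z → F a z ≡ false

  isolated-connected : ∀ {F : ES n} {a} → Isolated F a → ∀ {u} → Connected F a u → a ≡ u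
  isolated-connected {F} {a} iso (k , p) = go k p
    where
      go : ∀ k {u} → reach F k a u ≡ true → a ≡ u
      go zero    p = ≟≡true⇒≡ p
      go (suc k) p with reach-suc⁻ F k p
      ... | inj₁ p′ = go k p′
      ... | inj₂ (w , p′ , e) with refl ← go k p′ = ⊥-elim (≡true⇒≢false e (iso _))

  -- components X is countFin (isRoot X) by definition: a root is the least vertex of its component.
  isRoot : ES n → Fin n → Bool
  isRoot X v = not (anyFin (λ u → (toℕ u <ᵇ toℕ v) ∧ reach X n u v))

  isRoot⁺ : ∀ {X v} → (∀ u → toℕ u < toℕ v → ¬ Connected X u v) → isRoot X v ≡ true
  isRoot⁺ {X} {v} noSmaller = cong not (¬-not λ p →
    let u , q = anyFin≡true⁻ _ p
        u<ᵇv , u~v = ∧≡true⁻ (toℕ u <ᵇ toℕ v) q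
    in noSmaller u (<ᵇ⇒< _ _ (Equivalence.from T-≡ u<ᵇv)) (n , u~v))

  isRoot≡false : ∀ {X u v} → toℕ u < toℕ v → Connected X u v → isRoot X v ≡ false
  isRoot≡false {X} {u} u<v u~v =
    cong not (anyFin≡true⁺ _ u (∧≡true⁺ (Equivalence.to T-≡ (<⇒<ᵇ u<v)) (connected⇒reach X u~v)))

  isRoot-mono : ∀ {X Y : ES n} → X ⊆ₑ Y → ∀ v → isRoot Y v ≡ true → isRoot X v ≡ true
  isRoot-mono X⊆Y v p = isRoot⁺ λ u u<v u~v → ≡true⇒≢false p (isRoot≡false u<v (connected-mono X⊆Y u~v))

  root-exists : ∀ (X : ES n) v → ∃[ r ] (Connected X r v × isRoot X r ≡ true)
  root-exists X v
    with ¬∀⟶∃¬-smallest n (λ u → reach X n u v ≡ false) (λ u → reach X n u v ≟ᵇ false)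
                          (λ unreached → ≡true⇒≢false (reach-refl X n v) (unreached v))
  ... | r , r→v , below-r = r , r~v , isRoot⁺ λ u u<r u~r →
    ≡true⇒≢false (connected⇒reach X (connected-trans X u~r r~v))
                 (subst (λ w → reach X n w v ≡ false) (inject-fromℕ< u<r) (below-r (F.fromℕ< u<r)))
    where
      r~v : Connected X r v
      r~v = n , ¬-not r→v
      inject-fromℕ< : ∀ {u} (u<r : toℕ u < toℕ r) → inject {i = r} (F.fromℕ< u<r) ≡ u
      inject-fromℕ< u<r = toℕ-injective (trans (toℕ-inject (F.fromℕ< u<r)) (toℕ-fromℕ< u<r))

  -- Roots of F′ are roots of F, and the larger of a and the root r of b's component is no longer one.
  components-<-joiningIsolated : ∀ {F F′ : ES n} {a b} → Sym F → F ⊆ₑ F′ → Isolated F a → a ≢ b →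
    Connected F′ a b → Connected F′ b a → components F′ < components F
  components-<-joiningIsolated {F} {F′} {a} {b} symF F⊆F′ iso a≢b a~b b~a
    with root-exists F b
  ... | r , r~b , root-r with <-cmp (toℕ a) (toℕ r)
  ... | tri< a<r _ _ = countFin-mono-< (isRoot F′) (isRoot F) (isRoot-mono F⊆F′) r
    (isRoot≡false a<r (connected-trans F′ a~b (connected-mono F⊆F′ (connected-sym F symF r~b)))) root-r
  ... | tri≈ _ a≡r _ =
    ⊥-elim (a≢b (isolated-connected iso (subst (λ w → Connected F w b) (sym (toℕ-injective a≡r)) r~b)))
  ... | tri> _ _ r<a = countFin-mono-< (isRoot F′) (isRoot F) (isRoot-mono F⊆F′) a
    (isRoot≡false r<a (connected-trans F′ (connected-mono F⊆F′ r~b) b~a))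
    (isRoot⁺ λ u u<a u~a → <-irrefl (cong toℕ (sym (isolated-connected iso (connected-sym F symF u~a)))) u<a)

  rank-addEdge-isolated : ∀ {F : ES n} {a b} → Sym F → a ≢ b → Isolated F a ⊎ Isolated F b →
    rank F < rank (addEdge F a b)
  rank-addEdge-isolated {F} {a} {b} symF a≢b iso = ∸-monoʳ-< (merge iso) (countFin≤n _)
    where
      ab = connected-edge (addEdge F a b) (addEdge-ab F a b)
      ba = connected-edge (addEdge F a b) (addEdge-ba F a b)
      merge : Isolated F a ⊎ Isolated F b → components (addEdge F a b) < components F
      merge (inj₁ isoA) = components-<-joiningIsolated symF (⊆-addEdge F a b) isoA a≢b ab ba
      merge (inj₂ isoB) =
        components-<-joiningIsolated symF (⊆-addEdge F a b) isoB (λ b≡a → a≢b (sym b≡a)) ba ab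

proper⊆ₑ⇒missingEdge : ∀ {n} {F X : ES n} → F ⊆ₑ X → ¬ F ≐ X → ∃[ a ] ∃[ b ] (F a b ≡ false × X a b ≡ true)
proper⊆ₑ⇒missingEdge {n} {F} {X} F⊆X F≠X
  with ¬∀⟶∃¬ n _ (λ a → all? λ b → F a b ≟ᵇ X a b) F≠X
... | a , F≠Xa with ¬∀⟶∃¬ n _ (λ b → F a b ≟ᵇ X a b) F≠Xa
...   | b , Fab≠Xab = a , b , strictly-implies (F⊆X a b) Fab≠Xab

∪ₑ-coverʳ : ∀ {n} {X F F′ : ES n} → (F ∪ₑ F′) ≐ X → ∀ {i j} → X i j ≡ true → F i j ≡ false → F′ i j ≡ true
∪ₑ-coverʳ {F = F} {F′} cover {i} {j} Xij Fij = trans (cong (_∨ F′ i j) (sym Fij)) (trans (cover i j) Xij)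

module _ {n : ℕ} where

  deleteVertex : ES n → Fin n → ES n
  deleteVertex X u i j = X i j ∧ (not ⌊ i ≟ u ⌋ ∧ not ⌊ j ≟ u ⌋)

  deleteVertex⁺ : ∀ X u {i j} → X i j ≡ true → i ≢ u → j ≢ u → deleteVertex X u i j ≡ true
  deleteVertex⁺ X u Xij i≢u j≢u = ∧≡true⁺ Xij (∧≡true⁺ (cong not (≟-≢ i≢u)) (cong not (≟-≢ j≢u)))

  deleteVertex⁻ : ∀ X u {i j} → deleteVertex X u i j ≡ true → X i j ≡ true × i ≢ u × j ≢ u
  deleteVertex⁻ X u {i} {j} p with ∧≡true⁻ (X i j) p
  ... | Xij , q with ∧≡true⁻ (not ⌊ i ≟ u ⌋) q
  ...   | i≢u , j≢u = Xij , not≟⇒≢ i≢u , not≟⇒≢ j≢u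

  deleteVertex-isolated : ∀ X u → Isolated (deleteVertex X u) u
  deleteVertex-isolated X u j = ¬-not λ p → proj₁ (proj₂ (deleteVertex⁻ X u p)) refl

  deleteVertex-sym : ∀ {X} u → Sym X → Sym (deleteVertex X u)
  deleteVertex-sym {X} u symX i j = ⇔true⇒≡ flip flip
    where
      flip : ∀ {i j} → deleteVertex X u i j ≡ true → deleteVertex X u j i ≡ true
      flip {i} {j} p = let Xij , i≢u , j≢u = deleteVertex⁻ X u p in
                       deleteVertex⁺ X u (trans (symX j i) Xij) j≢u i≢u

module _ {n : ℕ} (G : Graph n) where

  adj⇒≢ : ∀ {i j} → adj G i j ≡ true → i ≢ j
  adj⇒≢ {i} p refl = ≡true⇒≢false p (irrefl G i)

  adj-sym : ∀ {i j} → adj G i j ≡ true → adj G j i ≡ true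
  adj-sym {i} {j} p = trans (Graph.sym G j i) p

  isolatedEnd⇒isFlatIn : ∀ {X F : ES n} → Sym F → F ⊆ₑ X → X ⊆ₑ E G →
    (∀ a b → X a b ≡ true → F a b ≡ false → Isolated F a ⊎ Isolated F b) → IsFlatIn X F
  isolatedEnd⇒isFlatIn symF F⊆X X⊆E isolatedEnd = symF , F⊆X , λ a b Xab Fab →
    rank-addEdge-isolated symF (adj⇒≢ (X⊆E a b Xab)) (isolatedEnd a b Xab Fab)

  cliqueEdges⁺ : ∀ C {i j} → C i ≡ true → C j ≡ true → adj G i j ≡ true → cliqueEdges G C i j ≡ true
  cliqueEdges⁺ C Ci Cj Eij = ∧≡true⁺ Ci (∧≡true⁺ Cj Eij)

  cliqueEdges⁻ : ∀ C {i j} → cliqueEdges G C i j ≡ true → C i ≡ true × C j ≡ true × adj G i j ≡ true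
  cliqueEdges⁻ C {i} {j} p with ∧≡true⁻ (C i) p
  ... | Ci , q = Ci , ∧≡true⁻ (C j) q

  cliqueEdges⊆E : ∀ C → cliqueEdges G C ⊆ₑ E G
  cliqueEdges⊆E C i j p = proj₂ (proj₂ (cliqueEdges⁻ C p))

  cliqueEdges-sym : ∀ C → Sym (cliqueEdges G C)
  cliqueEdges-sym C i j = ⇔true⇒≡ flip flip
    where
      flip : ∀ {i j} → cliqueEdges G C i j ≡ true → cliqueEdges G C j i ≡ true
      flip p = let Ci , Cj , Eij = cliqueEdges⁻ C p in cliqueEdges⁺ C Cj Ci (adj-sym Eij)

  cliqueEdges-mono : ∀ {C D} → _⊆ᵥ_ G C D → cliqueEdges G C ⊆ₑ cliqueEdges G D
  cliqueEdges-mono {C} {D} C⊆D i j p =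
    let Ci , Cj , Eij = cliqueEdges⁻ C p in cliqueEdges⁺ D (C⊆D i Ci) (C⊆D j Cj) Eij

  cliqueEdges-cong : ∀ {C D} → _≐ᵥ_ G C D → cliqueEdges G C ≐ cliqueEdges G D
  cliqueEdges-cong C≗D i j = cong₂ (λ x y → x ∧ y ∧ adj G i j) (C≗D i) (C≗D j)

  cliqueEdges-flat : ∀ C → IsFlat G (cliqueEdges G C)
  cliqueEdges-flat C = isolatedEnd⇒isFlatIn (cliqueEdges-sym C) (cliqueEdges⊆E C) (λ _ _ Eab → Eab) isolatedEnd
    where
      isolatedEnd : ∀ a b → E G a b ≡ true → cliqueEdges G C a b ≡ false →
        Isolated (cliqueEdges G C) a ⊎ Isolated (cliqueEdges G C) b
      isolatedEnd a b Eab Kab with C a in Ca | C b in Cb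
      ... | false | _     = inj₁ λ _ → refl
      ... | true  | false = inj₂ λ _ → refl
      ... | true  | true  = ⊥-elim (≡true⇒≢false Eab Kab)

  -- Some edge ab of the clique is missing from F. As F is closed, every vertex i of C is then on an edge iz
  -- missing from F (z = a or z = b); and if ij ∈ F then also jz ∉ F, so iz, zj ∈ F′, whence ij ∈ F′.
  cliqueEdges-round : ∀ {C} → IsClique G C → Round (cliqueEdges G C)
  cliqueEdges-round {C} clique (F , F′ , flatF , flatF′ , F≠X , F′≠X , cover) =
    F′≠X λ i j → ⇔true⇒≡ (proj₁ (proj₂ flatF′) i j) (X⊆F′ i j)
    where
      X = cliqueEdges G C
      symF = proj₁ flatF

      inX : ∀ {p q} → C p ≡ true → C q ≡ true → p ≢ q → X p q ≡ true
      inX Cp Cq p≢q = cliqueEdges⁺ C Cp Cq (clique _ _ Cp Cq p≢q)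

      inF′ : ∀ {p q} → X p q ≡ true → F p q ≡ false → F′ p q ≡ true
      inF′ = ∪ₑ-coverʳ {F = F} {F′} cover

      escape : ∀ i → C i ≡ true → ∃[ z ] (C z ≡ true × i ≢ z × F i z ≡ false)
      escape i Ci with proper⊆ₑ⇒missingEdge (proj₁ (proj₂ flatF)) F≠X
      ... | a , b , Fab , Xab with cliqueEdges⁻ C Xab | i ≟ a
      ...   | Ca , Cb , Eab | yes refl = b , Cb , adj⇒≢ Eab , Fab
      ...   | Ca , Cb , Eab | no i≢a with F i a in Fia
      ...     | false = a , Ca , i≢a , Fia
      ...     | true  = b , Cb , i≢b , Fib
        where
          i≢b : i ≢ b
          i≢b refl = ≡true⇒≢false (trans (symF a i) Fia) Fab
          Fib : F i b ≡ false
          Fib = ¬-not λ Fib → ≡true⇒≢false (flat-trans flatF (trans (symF a i) Fia) Fib Xab) Fab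

      X⊆F′ : ∀ i j → X i j ≡ true → F′ i j ≡ true
      X⊆F′ i j Xij with F i j in Fij | cliqueEdges⁻ C Xij
      ... | false | _ = inF′ Xij Fij
      ... | true  | Ci , Cj , _ with escape i Ci
      ...   | z , Cz , i≢z , Fiz =
        flat-trans flatF′ (inF′ (inX Ci Cz i≢z) Fiz) (inF′ (inX Cz Cj z≢j) Fzj) Xij
        where
          z≢j : z ≢ j
          z≢j refl = ≡true⇒≢false Fij Fiz
          Fzj : F z j ≡ false
          Fzj = trans (symF z j) (¬-not λ Fjz → ≡true⇒≢false (flat-trans flatF Fij Fjz (inX Ci Cz i≢z)) Fiz)

  deleteVertex-flat : ∀ {R} → Sym R → R ⊆ₑ E G → ∀ u → IsFlatIn R (deleteVertex R u)
  deleteVertex-flat {R} symR R⊆E u =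
    isolatedEnd⇒isFlatIn (deleteVertex-sym u symR) (λ i j p → proj₁ (deleteVertex⁻ R u p)) R⊆E isolatedEnd
    where
      isolatedEnd : ∀ a b → R a b ≡ true → deleteVertex R u a b ≡ false →
        Isolated (deleteVertex R u) a ⊎ Isolated (deleteVertex R u) b
      isolatedEnd a b Rab Dab = ends (a ≟ u) (b ≟ u)
        where
          ends : Dec (a ≡ u) → Dec (b ≡ u) → Isolated (deleteVertex R u) a ⊎ Isolated (deleteVertex R u) b
          ends (yes refl) _        = inj₁ (deleteVertex-isolated R a)
          ends (no _)     (yes refl) = inj₂ (deleteVertex-isolated R b)
          ends (no a≢u)   (no b≢u)   = ⊥-elim (≡true⇒≢false (deleteVertex⁺ R u Rab a≢u b≢u) Dab)

  -- Otherwise deleting u, resp. w, yields a vertical cover of M|R.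
  round-adjacent : ∀ {R} → Sym R → R ⊆ₑ E G → Round R →
    ∀ {u w a b} → R u a ≡ true → R w b ≡ true → u ≢ w → R u w ≡ true
  round-adjacent {R} symR R⊆E roundR {u} {w} Rua Rwb u≢w with R u w in Ruw
  ... | true  = refl
  ... | false = ⊥-elim (roundR (deleteVertex R u , deleteVertex R w ,
                                deleteVertex-flat symR R⊆E u , deleteVertex-flat symR R⊆E w ,
                                shrinks Rua , shrinks Rwb , covers))
    where
      shrinks : ∀ {x y} → R x y ≡ true → ¬ deleteVertex R x ≐ R
      shrinks {x} {y} Rxy same = ≡true⇒≢false (trans (same x y) Rxy) (deleteVertex-isolated R x y)

      kept : ∀ {i j} → R i j ≡ true → Dec (i ≡ u) → Dec (j ≡ u) →
        (deleteVertex R u ∪ₑ deleteVertex R w) i j ≡ true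
      kept Rij (no i≢u) (no j≢u) = ∨≡trueˡ⁺ _ (deleteVertex⁺ R u Rij i≢u j≢u)
      kept Rij (yes refl) _ = ∨≡trueʳ⁺ _ (deleteVertex⁺ R w Rij u≢w λ { refl → ≡true⇒≢false Rij Ruw })
      kept {i} Rij (no _) (yes refl) =
        ∨≡trueʳ⁺ _ (deleteVertex⁺ R w Rij (λ { refl → ≡true⇒≢false (trans (symR u i) Rij) Ruw }) u≢w)

      covers : (deleteVertex R u ∪ₑ deleteVertex R w) ≐ R
      covers i j = ⇔true⇒≡
        (λ p → [ (λ q → proj₁ (deleteVertex⁻ R u q)) , (λ q → proj₁ (deleteVertex⁻ R w q)) ] (∨≡true⁻ _ p))
        (λ Rij → kept Rij (i ≟ u) (j ≟ u))

  support : ES n → VS G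
  support R v = anyFin (R v)

  support⁺ : ∀ R {v z} → R v z ≡ true → support R v ≡ true
  support⁺ R {v} {z} = anyFin≡true⁺ (R v) z

  round-support-adjacent : ∀ {R} → Sym R → R ⊆ₑ E G → Round R →
    ∀ {u v} → support R u ≡ true → support R v ≡ true → u ≢ v → R u v ≡ true
  round-support-adjacent {R} symR R⊆E roundR {u} {v} Su Sv u≢v
    with anyFin≡true⁻ (R u) Su | anyFin≡true⁻ (R v) Sv
  ... | _ , Rua | _ , Rvb = round-adjacent symR R⊆E roundR Rua Rvb u≢v

  round-support-clique : ∀ {R} → Sym R → R ⊆ₑ E G → Round R → IsClique G (support R)
  round-support-clique symR R⊆E roundR u v Su Sv u≢v =
    R⊆E u v (round-support-adjacent symR R⊆E roundR Su Sv u≢v)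

  round≐cliqueEdges-support : ∀ {R} → Sym R → R ⊆ₑ E G → Round R → R ≐ cliqueEdges G (support R)
  round≐cliqueEdges-support {R} symR R⊆E roundR i j = ⇔true⇒≡
    (λ Rij → cliqueEdges⁺ (support R) (support⁺ R Rij) (support⁺ R (trans (symR j i) Rij)) (R⊆E i j Rij))
    (λ p → let Si , Sj , Eij = cliqueEdges⁻ (support R) p in
           round-support-adjacent symR R⊆E roundR Si Sj (adj⇒≢ Eij))

  pair : Fin n → Fin n → VS G
  pair v z u = ⌊ u ≟ v ⌋ ∨ ⌊ u ≟ z ⌋

  pair-left : ∀ v z → pair v z v ≡ true
  pair-left v z = ∨≡trueˡ⁺ _ (≟-refl v)

  pair-right : ∀ v z → pair v z z ≡ true
  pair-right v z = ∨≡trueʳ⁺ ⌊ z ≟ v ⌋ (≟-refl z)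

  pair-clique : ∀ {v z} → adj G v z ≡ true → IsClique G (pair v z)
  pair-clique {v} {z} Evz u w Pu Pw u≢w
    with ∨≡true⁻ ⌊ u ≟ v ⌋ Pu | ∨≡true⁻ ⌊ w ≟ v ⌋ Pw
  ... | inj₁ u≟v | inj₂ w≟z rewrite ≟≡true⇒≡ u≟v | ≟≡true⇒≡ w≟z = Evz
  ... | inj₂ u≟z | inj₁ w≟v rewrite ≟≡true⇒≡ u≟z | ≟≡true⇒≡ w≟v = adj-sym Evz
  ... | inj₁ u≟v | inj₁ w≟v = ⊥-elim (u≢w (trans (≟≡true⇒≡ u≟v) (sym (≟≡true⇒≡ w≟v))))
  ... | inj₂ u≟z | inj₂ w≟z = ⊥-elim (u≢w (trans (≟≡true⇒≡ u≟z) (sym (≟≡true⇒≡ w≟z))))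

  other-or-only : ∀ (C : VS G) v → (∃[ u ] (C u ≡ true × u ≢ v)) ⊎ (∀ u → C u ≡ true → u ≡ v)
  other-or-only C v with any? (λ u → (C u ≟ᵇ true) ×-dec ¬? (u ≟ v))
  ... | yes other = inj₁ other
  ... | no ∄other = inj₂ λ u Cu → decidable-stable (u ≟ v) λ u≢v → ∄other (u , Cu , u≢v)

  module _ (noIsolated : NoIsolatedVertices G) where

    maximalClique-nontrivial : ∀ {C} → MaximalClique G C → ∀ {c} → C c ≡ true → ∃[ c′ ] (C c′ ≡ true × c′ ≢ c)
    maximalClique-nontrivial {C} (_ , maximal) {c} Cc with other-or-only C c | noIsolated c
    ... | inj₁ other | _       = other
    ... | inj₂ only  | z , Ecz = z , Cz , λ z≡c → adj⇒≢ Ecz (sym z≡c)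
      where
        C⊆pair : _⊆ᵥ_ G C (pair c z)
        C⊆pair u Cu = subst (λ t → pair c z t ≡ true) (sym (only u Cu)) (pair-left c z)
        Cz : C z ≡ true
        Cz = trans (sym (maximal (pair c z) (pair-clique Ecz) C⊆pair z)) (pair-right c z)

    rotunda-nonempty : ∀ {R} → Rotunda G R → Fin n → ∃[ a ] ∃[ b ] R a b ≡ true
    rotunda-nonempty {R} (_ , _ , maximal) v with any? (λ a → any? λ b → R a b ≟ᵇ true) | noIsolated v
    ... | yes edge   | _       = edge
    ... | no ∄edge | z , Evz = ⊥-elim (∄edge (v , z , trans (sym (pairEdges≐R v z)) vz∈pairEdges))
      where
        pairEdges≐R : cliqueEdges G (pair v z) ≐ R
        pairEdges≐R = maximal (cliqueEdges G (pair v z)) (cliqueEdges-flat (pair v z))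
          (cliqueEdges-round (pair-clique Evz)) (λ a b Rab → ⊥-elim (∄edge (a , b , Rab)))
        vz∈pairEdges : cliqueEdges G (pair v z) v z ≡ true
        vz∈pairEdges = cliqueEdges⁺ (pair v z) (pair-left v z) (pair-right v z) Evz

    maximalClique⇒rotunda : ∀ {C} → MaximalClique G C → Rotunda G (cliqueEdges G C)
    maximalClique⇒rotunda {C} maxC@(clique , maximal) =
      cliqueEdges-flat C , cliqueEdges-round clique , rotunda-maximal
      where
        rotunda-maximal : ∀ R → IsFlat G R → Round R → cliqueEdges G C ⊆ₑ R → R ≐ cliqueEdges G C
        rotunda-maximal R (symR , R⊆E , _) roundR K⊆R i j =
          trans (round≐cliqueEdges-support symR R⊆E roundR i j)
                (cliqueEdges-cong (maximal (support R) (round-support-clique symR R⊆E roundR) C⊆S) i j)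
          where
            C⊆S : _⊆ᵥ_ G C (support R)
            C⊆S c Cc with maximalClique-nontrivial maxC Cc
            ... | c′ , Cc′ , c′≢c =
              support⁺ R (K⊆R c c′ (cliqueEdges⁺ C Cc Cc′ (clique c c′ Cc Cc′ λ c≡c′ → c′≢c (sym c≡c′))))

    rotunda⇒maximalClique : ∀ {R} → Rotunda G R → Σ (VS G) λ C → MaximalClique G C × R ≐ cliqueEdges G C
    rotunda⇒maximalClique {R} rotR@((symR , R⊆E , _) , roundR , maximal) =
      support R , (round-support-clique symR R⊆E roundR , support-maximal) , R≐KS
      where
        R≐KS = round≐cliqueEdges-support symR R⊆E roundR

        support-maximal : ∀ C′ → IsClique G C′ → _⊆ᵥ_ G (support R) C′ → _≐ᵥ_ G C′ (support R)
        support-maximal C′ clique′ S⊆C′ v = ⇔true⇒≡ C′⊆S (S⊆C′ v)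
          where
            KC′≐R : cliqueEdges G C′ ≐ R
            KC′≐R = maximal (cliqueEdges G C′) (cliqueEdges-flat C′) (cliqueEdges-round clique′)
              (λ i j Rij → cliqueEdges-mono S⊆C′ i j (trans (sym (R≐KS i j)) Rij))

            C′⊆S : C′ v ≡ true → support R v ≡ true
            C′⊆S C′v with rotunda-nonempty rotR v
            ... | a , b , Rab with a ≟ v
            ...   | yes refl = support⁺ R Rab
            ...   | no a≢v   = support⁺ R (trans (sym (KC′≐R v a))
                (cliqueEdges⁺ C′ C′v C′a (clique′ v a C′v C′a λ v≡a → a≢v (sym v≡a))))
              where C′a = S⊆C′ a (support⁺ R Rab)

clamp : ∀ len → ℕ → Fin (suc len)
clamp zero    _       = F.zero
clamp (suc l) zero    = F.zero
clamp (suc l) (suc m) = F.suc (clamp l m)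

toℕ-clamp : ∀ len {m} → m ≤ len → toℕ (clamp len m) ≡ m
toℕ-clamp zero    z≤n       = refl
toℕ-clamp (suc l) z≤n       = refl
toℕ-clamp (suc l) (s≤s m≤l) = cong suc (toℕ-clamp l m≤l)

module _ {n : ℕ} {G : Graph n} {x y : Fin n} (P : Path G x y) where
  open Path P

  pathVertex : ℕ → Fin n
  pathVertex m = p (clamp len m)

  pathVertex-start : pathVertex 0 ≡ x
  pathVertex-start = trans (cong p (toℕ-injective (toℕ-clamp len z≤n))) start

  pathVertex-end : pathVertex len ≡ y
  pathVertex-end = trans (cong p (toℕ-injective (trans (toℕ-clamp len ≤-refl) (sym (toℕ-fromℕ len))))) end

  pathVertex-step : ∀ m → m < len → adj G (pathVertex m) (pathVertex (suc m)) ≡ true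
  pathVertex-step m m<len =
    subst₂ (λ a b → adj G (p a) (p b) ≡ true) (sym clamp-m) (sym clamp-suc-m) (step (F.fromℕ< m<len))
    where
      clamp-m : clamp len m ≡ inject₁ (F.fromℕ< m<len)
      clamp-m = toℕ-injective (trans (toℕ-clamp len (<⇒≤ m<len))
                                     (sym (trans (toℕ-inject₁ _) (toℕ-fromℕ< m<len))))
      clamp-suc-m : clamp len (suc m) ≡ F.suc (F.fromℕ< m<len)
      clamp-suc-m = toℕ-injective (trans (toℕ-clamp len m<len) (cong suc (sym (toℕ-fromℕ< m<len))))

consec-sym : ∀ {n} (G : Graph n) k {x y} → Consec G k x y → Consec G k y x
consec-sym G k (inj₁ e)                = inj₂ (inj₁ e)
consec-sym G k (inj₂ (inj₁ e))         = inj₁ e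
consec-sym G k (inj₂ (inj₂ (inj₁ p))) = inj₂ (inj₂ (inj₂ p))
consec-sym G k (inj₂ (inj₂ (inj₂ p))) = inj₂ (inj₂ (inj₁ p))

module _ {n : ℕ} (G : Graph n) (chordal : Chordal G) where

  -- hub, q 0, …, q k would be a chordless cycle of length k + 2 ≥ 4.
  no-long-induced-cycle : ∀ {k} (hub : Fin n) (q : ℕ → Fin n) → 2 ≤ k →
    (∀ m → m ≤ k → hub ≢ q m) →
    (∀ a b → a < b → b ≤ k → q a ≢ q b) →
    adj G hub (q 0) ≡ true → adj G hub (q k) ≡ true →
    (∀ m → m < k → adj G (q m) (q (suc m)) ≡ true) →
    (∀ m → 0 < m → m < k → adj G hub (q m) ≢ true) →
    (∀ a b → suc a < b → b ≤ k → adj G (q a) (q b) ≢ true) → ⊥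
  no-long-induced-cycle {k} hub q k≥2 hub∉q q-injective hub-first hub-last q-path hub-chordless q-chordless =
    no-chord (chordal (suc (suc k)) cycle (s≤s (s≤s k≥2)) (cycle-injective , cycle-adjacent))
    where
      cycle : Fin (suc (suc k)) → Fin n
      cycle F.zero    = hub
      cycle (F.suc m) = q (toℕ m)

      toℕ≤k : ∀ (m : Fin (suc k)) → toℕ m ≤ k
      toℕ≤k m = ≤-pred (toℕ<n m)

      cycle-injective : Injective _≡_ _≡_ cycle
      cycle-injective {F.zero}  {F.zero}  _ = refl
      cycle-injective {F.zero}  {F.suc y} e = ⊥-elim (hub∉q (toℕ y) (toℕ≤k y) e)
      cycle-injective {F.suc x} {F.zero}  e = ⊥-elim (hub∉q (toℕ x) (toℕ≤k x) (sym e))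
      cycle-injective {F.suc x} {F.suc y} e with <-cmp (toℕ x) (toℕ y)
      ... | tri< x<y _ _ = ⊥-elim (q-injective _ _ x<y (toℕ≤k y) e)
      ... | tri≈ _ x≡y _ = cong F.suc (toℕ-injective x≡y)
      ... | tri> _ _ y<x = ⊥-elim (q-injective _ _ y<x (toℕ≤k x) (sym e))

      forward : ∀ x y → suc (toℕ x) ≡ toℕ y → adj G (cycle x) (cycle y) ≡ true
      forward F.zero    (F.suc y) e = subst (λ t → adj G hub (q t) ≡ true) (suc-injective e) hub-first
      forward (F.suc x) (F.suc y) e = subst (λ t → adj G (q (toℕ x)) (q t) ≡ true) (suc-injective e)
        (q-path (toℕ x) (subst (_≤ k) (sym (suc-injective e)) (toℕ≤k y)))

      closing : ∀ y → suc (toℕ y) ≡ suc (suc k) → adj G hub (cycle y) ≡ true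
      closing (F.suc y) e = subst (λ t → adj G hub (q t) ≡ true) (sym (suc-injective (suc-injective e))) hub-last

      cycle-adjacent : ∀ x y → Consec G (suc (suc k)) x y → adj G (cycle x) (cycle y) ≡ true
      cycle-adjacent x      y      (inj₁ e)                     = forward x y e
      cycle-adjacent x      y      (inj₂ (inj₁ e))              = adj-sym G (forward y x e)
      cycle-adjacent F.zero y      (inj₂ (inj₂ (inj₁ (_ , e)))) = closing y e
      cycle-adjacent x      F.zero (inj₂ (inj₂ (inj₂ (_ , e)))) = adj-sym G (closing x e)

      hub-chord : ∀ m → ¬ Consec G (suc (suc k)) F.zero (F.suc m) → adj G hub (q (toℕ m)) ≢ true
      hub-chord m ¬consec with m≤n⇒m<n∨m≡n (toℕ≤k m)
      ... | inj₂ m≡k = ⊥-elim (¬consec (inj₂ (inj₂ (inj₁ (refl , cong (λ t → suc (suc t)) m≡k)))))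
      ... | inj₁ m<k with toℕ m
      ...   | zero   = ⊥-elim (¬consec (inj₁ refl))
      ...   | suc m′ = hub-chordless (suc m′) (s≤s z≤n) m<k

      no-chord : ¬ HasChord G (suc (suc k)) cycle
      no-chord (F.zero  , F.zero  , x≢y , _       , _)     = x≢y refl
      no-chord (F.zero  , F.suc m , _   , ¬consec , chord) = hub-chord m ¬consec chord
      no-chord (F.suc m , F.zero  , _   , ¬consec , chord) =
        hub-chord m (λ c → ¬consec (consec-sym G _ c)) (adj-sym G chord)
      no-chord (F.suc x , F.suc y , x≢y , ¬consec , chord) with <-cmp (toℕ x) (toℕ y)
      ... | tri< x<y _ _ = q-chordless _ _ (≤∧≢⇒< x<y λ e → ¬consec (inj₁ (cong suc e))) (toℕ≤k y) chord
      ... | tri≈ _ x≡y _ = x≢y (cong F.suc (toℕ-injective x≡y))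
      ... | tri> _ _ y<x =
        q-chordless _ _ (≤∧≢⇒< y<x λ e → ¬consec (inj₂ (inj₁ (cong suc e)))) (toℕ≤k x) (adj-sym G chord)

  module AvoidingWalks (hub : Fin n) (S T₁ T₂ : VS G)
    (hub∈S : S hub ≡ true)
    (T₁⊆N : ∀ v → T₁ v ≡ true → adj G hub v ≡ true)
    (T₂⊆N : ∀ v → T₂ v ≡ true → adj G hub v ≡ true)
    (N⊆T₁∪T₂ : ∀ v → adj G hub v ≡ true → S v ≡ false → T₁ v ≡ true ⊎ T₂ v ≡ true)
    (T₁∩T₂⊆S : ∀ v → T₁ v ≡ true → T₂ v ≡ true → S v ≡ true)
    (T₁-T₂-nonadjacent : ∀ u v → T₁ u ≡ true → T₂ v ≡ true → S u ≡ false → S v ≡ false →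
                         adj G u v ≢ true)
    where

    record AvoidingWalk (k : ℕ) : Set where
      field
        vertex : ℕ → Fin n
        step   : ∀ m → m < k → adj G (vertex m) (vertex (suc m)) ≡ true
        avoids : ∀ m → m ≤ k → S (vertex m) ≡ false
        starts : T₁ (vertex 0) ≡ true
        ends   : T₂ (vertex k) ≡ true

    Shorter : ℕ → Set
    Shorter k = ∃[ j ] (j < k × AvoidingWalk j)

    module _ {k : ℕ} (w : AvoidingWalk k) where
      open AvoidingWalk w

      prefix : ∀ a → a < k → T₂ (vertex a) ≡ true → Shorter k
      prefix a a<k T₂a = a , a<k , record
        { vertex = vertex
        ; step   = λ m m<a → step m (<-trans m<a a<k)
        ; avoids = λ m m≤a → avoids m (≤-trans m≤a (<⇒≤ a<k))
        ; starts = starts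
        ; ends   = T₂a
        }

      suffix : ∀ b → 0 < b → b ≤ k → T₁ (vertex b) ≡ true → Shorter k
      suffix b 0<b b≤k T₁b = k ∸ b , ∸-monoʳ-< 0<b b≤k , record
        { vertex = λ m → vertex (m + b)
        ; step   = λ m m<k∸b → step (m + b) (subst (m + b <_) (m∸n+n≡m b≤k) (+-monoˡ-< b m<k∸b))
        ; avoids = λ m m≤k∸b → avoids (m + b) (subst (m + b ≤_) (m∸n+n≡m b≤k) (+-monoˡ-≤ b m≤k∸b))
        ; starts = T₁b
        ; ends   = subst (λ t → T₂ (vertex t) ≡ true) (sym (m∸n+n≡m b≤k)) ends
        }

      shortcut : ∀ a b → suc a < b → b ≤ k → adj G (vertex a) (vertex b) ≡ true → Shorter k
      shortcut a b a+1<b b≤k chord = k ∸ d , ∸-monoʳ-< (m<n⇒0<n∸m a+1<b) d≤k , record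
        { vertex = vertex′ ; step = step′ ; avoids = avoids′ ; starts = starts′ ; ends = ends′ }
        where
          d = b ∸ suc a
          b≡a+1+d : b ≡ suc a + d
          b≡a+1+d = sym (m+[n∸m]≡n (<⇒≤ a+1<b))
          d≤k : d ≤ k
          d≤k = ≤-trans (m∸n≤m b (suc a)) b≤k
          a<k∸d : a < k ∸ d
          a<k∸d = subst (_≤ k ∸ d) (trans (cong (_∸ d) b≡a+1+d) (m+n∸n≡m (suc a) d)) (∸-monoˡ-≤ d b≤k)

          vertex′ : ℕ → Fin n
          vertex′ m with m ≤? a
          ... | yes _ = vertex m
          ... | no  _ = vertex (m + d)

          starts′ : T₁ (vertex′ 0) ≡ true
          starts′ with 0 ≤? a
          ... | yes _   = starts
          ... | no  0≰a = ⊥-elim (0≰a z≤n)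

          ends′ : T₂ (vertex′ (k ∸ d)) ≡ true
          ends′ with k ∸ d ≤? a
          ... | yes k∸d≤a = ⊥-elim (<⇒≱ a<k∸d k∸d≤a)
          ... | no  _     = subst (λ t → T₂ (vertex t) ≡ true) (sym (m∸n+n≡m d≤k)) ends

          avoids′ : ∀ m → m ≤ k ∸ d → S (vertex′ m) ≡ false
          avoids′ m m≤k∸d with m ≤? a
          ... | yes m≤a = avoids m (≤-trans m≤a (≤-trans (n≤1+n a) (<⇒≤ (<-≤-trans a+1<b b≤k))))
          ... | no  _   = avoids (m + d) (subst (m + d ≤_) (m∸n+n≡m d≤k) (+-monoˡ-≤ d m≤k∸d))

          step′ : ∀ m → m < k ∸ d → adj G (vertex′ m) (vertex′ (suc m)) ≡ true
          step′ m m<k∸d with m ≤? a | suc m ≤? a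
          ... | yes _   | yes m<a = step m (<-≤-trans m<a (≤-trans (n≤1+n a) (<⇒≤ (<-≤-trans a+1<b b≤k))))
          ... | yes m≤a | no  m≮a = subst (λ t → adj G (vertex t) (vertex (suc t + d)) ≡ true)
                                          (≤-antisym (≤-pred (≰⇒> m≮a)) m≤a)
                                          (subst (λ t → adj G (vertex a) (vertex t) ≡ true) b≡a+1+d chord)
          ... | no  m≰a | yes m<a = ⊥-elim (m≰a (<⇒≤ m<a))
          ... | no  _   | no  _   = step (m + d) (subst (m + d <_) (m∸n+n≡m d≤k) (+-monoˡ-< d m<k∸d))

    -- A shortest avoiding walk, closed up through the hub, would be an induced cycle of length ≥ 4.
    no-avoiding-walk : ∀ k → ¬ AvoidingWalk k
    no-avoiding-walk = <-rec (λ k → ¬ AvoidingWalk k) shortest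
      where
        shortest : ∀ k → (∀ {j} → j < k → ¬ AvoidingWalk j) → ¬ AvoidingWalk k
        shortest zero _ w = ≡true⇒≢false (T₁∩T₂⊆S _ starts ends) (avoids 0 z≤n)
          where open AvoidingWalk w
        shortest (suc zero) _ w =
          T₁-T₂-nonadjacent _ _ starts ends (avoids 0 z≤n) (avoids 1 ≤-refl) (step 0 (s≤s z≤n))
          where open AvoidingWalk w
        shortest k@(suc (suc _)) none-shorter w = no-long-induced-cycle hub vertex (s≤s (s≤s z≤n))
          (λ m m≤k hub≡ → ≡true⇒≢false (subst (λ t → S t ≡ true) hub≡ hub∈S) (avoids m m≤k))
          vertex-injective (T₁⊆N _ starts) (T₂⊆N _ ends) step hub-chordless vertex-chordless
          where
            open AvoidingWalk w
            impossible : Shorter k → ⊥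
            impossible (j , j<k , w′) = none-shorter j<k w′

            vertex-injective : ∀ a b → a < b → b ≤ k → vertex a ≢ vertex b
            vertex-injective a b a<b b≤k a≡b with m≤n⇒m<n∨m≡n b≤k
            ... | inj₂ refl = impossible (prefix w a a<b (subst (λ t → T₂ t ≡ true) (sym a≡b) ends))
            ... | inj₁ b<k  = impossible (shortcut w a (suc b) (s≤s a<b) b<k
                                (subst (λ t → adj G t (vertex (suc b)) ≡ true) (sym a≡b) (step b b<k)))

            hub-chordless : ∀ m → 0 < m → m < k → adj G hub (vertex m) ≢ true
            hub-chordless m 0<m m<k hub~m with N⊆T₁∪T₂ _ hub~m (avoids m (<⇒≤ m<k))
            ... | inj₁ T₁m = impossible (suffix w m 0<m (<⇒≤ m<k) T₁m)
            ... | inj₂ T₂m = impossible (prefix w m m<k T₂m)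

            vertex-chordless : ∀ a b → suc a < b → b ≤ k → adj G (vertex a) (vertex b) ≢ true
            vertex-chordless a b a+1<b b≤k chord = impossible (shortcut w a b a+1<b b≤k chord)

  open AvoidingWalks using (no-avoiding-walk)

  flatCover-separates : ∀ {C₁ C₂ F₁ F₂} → IsClique G C₁ → IsClique G C₂ → IsFlat G F₁ → IsFlat G F₂ →
    (F₁ ∪ₑ F₂) ≐ E G → cliqueEdges G C₁ ⊆ₑ F₁ → cliqueEdges G C₂ ⊆ₑ F₂ →
    (F₁ ∩ₑ F₂) ≐ (cliqueEdges G C₁ ∩ₑ cliqueEdges G C₂) → ∀ {i} → C₁ i ≡ true → C₂ i ≡ true →
    ∀ x y → C₁ x ≡ true → C₂ x ≡ false → C₂ y ≡ true → C₁ y ≡ false →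
    (P : Path G x y) → ∃[ t ] (C₁ (Path.p P t) ≡ true × C₂ (Path.p P t) ≡ true)
  flatCover-separates {C₁} {C₂} {F₁} {F₂} clique₁ clique₂ flat₁ flat₂ cover K₁⊆F₁ K₂⊆F₂ F₁∩F₂≐K₁∩K₂
                      {i} C₁i C₂i x y C₁x C₂x C₂y C₁y P
    with any? (λ t → (C₁ (Path.p P t) ≟ᵇ true) ×-dec (C₂ (Path.p P t) ≟ᵇ true))
  ... | yes common = common
  ... | no  none   = ⊥-elim (no-avoiding-walk i S T₁ T₂ (∧≡true⁺ C₁i C₂i)
                              (λ _ → proj₁ ∘ ∧≡true⁻ _) (λ _ → proj₁ ∘ ∧≡true⁻ _)
                              N⊆T₁∪T₂ T₁∩T₂⊆S T₁-T₂-nonadjacent (Path.len P) walk)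
    where
      S T₁ T₂ : VS G
      S v  = C₁ v ∧ C₂ v
      T₁ v = adj G i v ∧ F₁ i v
      T₂ v = adj G i v ∧ F₂ i v

      N⊆T₁∪T₂ : ∀ v → adj G i v ≡ true → S v ≡ false → T₁ v ≡ true ⊎ T₂ v ≡ true
      N⊆T₁∪T₂ v i~v _ with ∨≡true⁻ (F₁ i v) (trans (cover i v) i~v)
      ... | inj₁ F₁iv = inj₁ (∧≡true⁺ i~v F₁iv)
      ... | inj₂ F₂iv = inj₂ (∧≡true⁺ i~v F₂iv)

      T₁∩T₂⊆S : ∀ v → T₁ v ≡ true → T₂ v ≡ true → S v ≡ true
      T₁∩T₂⊆S v T₁v T₂v =
        let F₁iv = proj₂ (∧≡true⁻ (adj G i v) T₁v)
            F₂iv = proj₂ (∧≡true⁻ (adj G i v) T₂v)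
            K₁iv , K₂iv = ∧≡true⁻ (cliqueEdges G C₁ i v) (trans (sym (F₁∩F₂≐K₁∩K₂ i v)) (∧≡true⁺ F₁iv F₂iv))
        in ∧≡true⁺ (proj₁ (proj₂ (cliqueEdges⁻ G C₁ K₁iv))) (proj₁ (proj₂ (cliqueEdges⁻ G C₂ K₂iv)))

      -- An edge uv in F₁ (resp. F₂) would put iv into F₁ (resp. iu into F₂) by closure.
      T₁-T₂-nonadjacent : ∀ u v → T₁ u ≡ true → T₂ v ≡ true → S u ≡ false → S v ≡ false → adj G u v ≢ true
      T₁-T₂-nonadjacent u v T₁u T₂v Su Sv u~v with ∧≡true⁻ (adj G i u) T₁u | ∧≡true⁻ (adj G i v) T₂v
      ... | i~u , F₁iu | i~v , F₂iv with ∨≡true⁻ (F₁ u v) (trans (cover u v) u~v)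
      ...   | inj₁ F₁uv = ≡true⇒≢false (T₁∩T₂⊆S v (∧≡true⁺ i~v (flat-trans flat₁ F₁iu F₁uv i~v)) T₂v) Sv
      ...   | inj₂ F₂uv = ≡true⇒≢false (T₁∩T₂⊆S u T₁u
                            (∧≡true⁺ i~u (flat-trans flat₂ F₂iv (trans (proj₁ flat₂ v u) F₂uv) i~u))) Su

      walk : AvoidingWalks.AvoidingWalk i S T₁ T₂ _ _ _ _ _ _ (Path.len P)
      walk = record
        { vertex = pathVertex P
        ; step   = pathVertex-step P
        ; avoids = λ m _ → ¬-not λ Sm → none (clamp (Path.len P) m , ∧≡true⁻ _ Sm)
        ; starts = subst (λ t → T₁ t ≡ true) (sym (pathVertex-start P))
                     (∧≡true⁺ i~x (K₁⊆F₁ i x (cliqueEdges⁺ G C₁ C₁i C₁x i~x)))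
        ; ends   = subst (λ t → T₂ t ≡ true) (sym (pathVertex-end P))
                     (∧≡true⁺ i~y (K₂⊆F₂ i y (cliqueEdges⁺ G C₂ C₂i C₂y i~y)))
        }
        where
          i~x = clique₁ i x C₁i C₁x λ i≡x → ≡true⇒≢false (subst (λ t → C₂ t ≡ true) i≡x C₂i) C₂x
          i~y = clique₂ i y C₂i C₂y λ i≡y → ≡true⇒≢false (subst (λ t → C₁ t ≡ true) i≡y C₁i) C₁y

  rotundaAdj⇒reducedCliqueAdj : ∀ {C₁ C₂} → IsClique G C₁ → IsClique G C₂ →
    RotundaAdj G (cliqueEdges G C₁) (cliqueEdges G C₂) → ReducedCliqueAdj G C₁ C₂
  rotundaAdj⇒reducedCliqueAdj {C₁} {C₂} clique₁ clique₂
    (K₁≠K₂ , (i , _ , K₁ij , K₂ij) , _ , _ , (flat₁ , _) , (flat₂ , _) , _ , _ , cover , K₁⊆F₁ , K₂⊆F₂ , F₁∩F₂≐) =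
    (λ C₁≐C₂ → K₁≠K₂ (cliqueEdges-cong G C₁≐C₂)) ,
    (i , C₁i , C₂i) ,
    flatCover-separates clique₁ clique₂ flat₁ flat₂ cover K₁⊆F₁ K₂⊆F₂ F₁∩F₂≐ C₁i C₂i
    where
      C₁i = proj₁ (cliqueEdges⁻ G C₁ K₁ij)
      C₂i = proj₁ (cliqueEdges⁻ G C₂ K₂ij)

mainTheorem8 : ∀ {n : ℕ} (G : Graph n) → Chordal G → NoIsolatedVertices G →
    ((C : VS G) → MaximalClique G C → Rotunda G (cliqueEdges G C))
    × ((R : ES n) → Rotunda G R → Σ (VS G) λ C → MaximalClique G C × R ≐ cliqueEdges G C)
    × ((C₁ C₂ : VS G) → MaximalClique G C₁ → MaximalClique G C₂ →
        RotundaAdj G (cliqueEdges G C₁) (cliqueEdges G C₂) → ReducedCliqueAdj G C₁ C₂)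
mainTheorem8 G chordal noIsolated =
  (λ C → maximalClique⇒rotunda G noIsolated) ,
  (λ R → rotunda⇒maximalClique G noIsolated) ,
  (λ C₁ C₂ maxC₁ maxC₂ → rotundaAdj⇒reducedCliqueAdj G chordal (proj₁ maxC₁) (proj₁ maxC₂))
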